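{- Let $D=(E,\mathcal F)$ be a vf-safe delta-matroid and $e\in E$. Then $$r_{\max}(D)=\begin{cases}r_{\max}(D+e)&\text{if $e$ is an orientable ribbon dual-loop},\\ r_{\max}(D+e)-1&\text{if $e$ is not a ribbon dual-loop},\\ r_{\max}(D+e)+1&\text{if $e$ is a non-orientable ribbon dual-loop}.\end{cases}$$
   Context: A delta-matroid $D=(E,\mathcal F)$: finite $E$ and nonempty family $\mathcal F$ of subsets with: for $X,Y\in\mathcal F$ and $u\in X\triangle Y$ there is $v\in X\triangle Y$ with $X\triangle\{u,v\}\in\mathcal F$. Twist: $D*A=(E,\{A\triangle X:X\in\mathcal F\})$. Loop complementation: $D+e=(E,\mathcal F\triangle\{F\cup e:F\in\mathcal F,e\notin F\})$. $D$ is vf-safe if every sequence of twists and loop complementations yields a delta-matroid. $r_{\max}(D)$ is the maximum cardinality of a feasible set; $\mathcal F_{\max}$ is the set of maximum-cardinality feasible sets and $D_{\max}=(E,\mathcal F_{\max})$. $e$ is a ribbon dual-loop of $D$ if $e$ lies in every set of $\mathcal F_{\max}$ (a coloop of $D_{\max}$); a ribbon dual-loop is orientable if $e$ is not in every maximum-cardinality feasible set of $D*\{e\}$, and non-orientable if it is. -}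

module Defs where

open import Data.Nat using (ℕ; _≤_)
open import Data.Bool using (Bool; true; false; _xor_; _∧_)
open import Data.Fin using (Fin)
open import Data.Fin.Subset using (Subset; _∈_; _∉_; ⁅_⁆; _∪_; _─_; ∣_∣)
open import Data.Vec using (lookup; zipWith)
open import Data.List using (List; []; _∷_)
open import Data.Product using (Σ; _×_; ∃)
open import Relation.Binary.PropositionalEquality using (_≡_)
open import Relation.Nullary using (¬_)

-- Ground set E = Fin n; a set family on E is given by its (decidable)
-- membership predicate: F X ≡ true  iff  X is a member of the family.
Family : ℕ → Set
Family n = Subset n → Bool

_△_ : ∀ {n} → Subset n → Subset n → Subset n
X △ Y = zipWith _xor_ X Y

Feasible : ∀ {n} → Family n → Subset n → Set
Feasible F X = F X ≡ true

IsDeltaMatroid : ∀ {n} → Family n → Set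
IsDeltaMatroid {n} F =
  (∃ λ X → Feasible F X) ×
  (∀ X Y → Feasible F X → Feasible F Y → ∀ u → u ∈ (X △ Y) →
     Σ (Fin n) λ v → v ∈ (X △ Y) × Feasible F (X △ (⁅ u ⁆ ∪ ⁅ v ⁆)))

twist : ∀ {n} → Subset n → Family n → Family n
twist A F X = F (A △ X)

-- Loop complementation D + e : F △ {X ∪ e : X ∈ F, e ∉ X}.
-- Y is of the form X ∪ e with e ∉ X, X ∈ F  iff  e ∈ Y and Y ─ {e} ∈ F.
loopc : ∀ {n} → Fin n → Family n → Family n
loopc e F Y = F Y xor (lookup Y e ∧ F (Y ─ ⁅ e ⁆))

data Op (n : ℕ) : Set where
  tw : Subset n → Op n
  lc : Fin n → Op n

applyOps : ∀ {n} → List (Op n) → Family n → Family n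
applyOps []            F = F
applyOps (tw A ∷ ops)  F = applyOps ops (twist A F)
applyOps (lc e ∷ ops)  F = applyOps ops (loopc e F)

VfSafe : ∀ {n} → Family n → Set
VfSafe F = ∀ ops → IsDeltaMatroid (applyOps ops F)

IsMaxFeasible : ∀ {n} → Family n → Subset n → Set
IsMaxFeasible F X = Feasible F X × (∀ Y → Feasible F Y → ∣ Y ∣ ≤ ∣ X ∣)

IsRmax : ∀ {n} → Family n → ℕ → Set
IsRmax F k = (∃ λ X → Feasible F X × ∣ X ∣ ≡ k) × (∀ Y → Feasible F Y → ∣ Y ∣ ≤ k)

RibbonDualLoop : ∀ {n} → Family n → Fin n → Set
RibbonDualLoop F e = ∀ X → IsMaxFeasible F X → e ∈ X

InAllMaxOfTwist : ∀ {n} → Family n → Fin n → Set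
InAllMaxOfTwist F e = ∀ X → IsMaxFeasible (twist ⁅ e ⁆ F) X → e ∈ X

OrientableRDL : ∀ {n} → Family n → Fin n → Set
OrientableRDL F e = RibbonDualLoop F e × ¬ InAllMaxOfTwist F e

NonOrientableRDL : ∀ {n} → Family n → Fin n → Set
NonOrientableRDL F e = RibbonDualLoop F e × InAllMaxOfTwist F e

-- Write r for r_max(D). Loop complementation at e only toggles sets Y ∋ e,
-- which become feasible iff exactly one of Y and Y − e is; hence
-- r_max(D + e) ≤ r + 1, with equality iff some maximum feasible set X avoids e
-- (X ∪ e is then too large for D but feasible in D + e).
--
-- If e is a ribbon dual-loop, every feasible set avoiding e has size < r, and
-- everything hinges on whether some feasible W with |W| = r − 1 avoids e.
-- If one does, then a set Y ∋ e of size r is feasible iff Y − e is: move a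
-- feasible set of the other level towards Y or Y − e by symmetric exchange,
-- one swap at a time, since near the top an exchange can neither add two
-- elements nor create a set of size r avoiding e. So D + e has no feasible set
-- of size r but keeps W, giving r_max(D + e) = r − 1; and in D * e the sets
-- W ∪ e have size r, contain e and are maximum, so e is non-orientable. If none
-- does, a maximum feasible X ∋ e stays feasible in D + e, so r_max(D + e) = r,
-- and X − e is a maximum feasible set of D * e avoiding e: e is orientable.

module Submission where

open import Defs
open import Data.Bool using (true; false; _xor_)
import Data.Bool as Bool
open import Data.Bool.Properties
  using (xor-comm; xor-assoc; xor-identityˡ; xor-identityʳ; xor-same; ¬-not)
open import Data.Empty using (⊥-elim)
open import Data.Fin using (Fin; zero; suc)
import Data.Fin as Fin
open import Data.Fin.Subset using (Subset; inside; outside; ⊥; ⁅_⁆; _∪_; _─_; _∈_; _∉_; ∣_∣)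
open import Data.Fin.Subset.Properties
  using (_∈?_; drop-there; x∈⁅x⁆; x≢y⇒x∉⁅y⁆; ∪-idem; ∪-identityˡ; ∪-identityʳ; p─⊥≡p; anySubset?)
open import Data.Nat using (ℕ; suc; _≤_; _<_; s≤s; s≤s⁻¹)
import Data.Nat as ℕ
open import Data.Nat.Induction using (<-wellFounded)
open import Data.Nat.Properties
  using (≤-trans; ≤-reflexive; ≤-antisym; n≤1+n; m≤n⇒m≤1+n; ≤∧≢⇒<; 1+n≰n; <⇒≱; suc-injective; module ≤-Reasoning)
open import Data.Product using (_×_; _,_; ∃; proj₁; proj₂)
open import Data.Sum using (_⊎_; inj₁; inj₂; [_,_]′)
import Data.Sum as Sum
open import Data.Vec using ([]; _∷_; here; there; lookup)
import Data.List as List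
open import Data.Vec.Properties
  using (zipWith-comm; zipWith-assoc; zipWith-identityˡ; zipWith-identityʳ; lookup-zipWith; []=⇒lookup; lookup⇒[]=)
open import Function using (_∘_)
open import Induction.WellFounded using (Acc; acc)
open import Relation.Nullary using (¬_; yes; no)
open import Relation.Nullary.Decidable using (decidable-stable; ¬?; _×-dec_)
open import Relation.Binary.PropositionalEquality

private
  variable
    n : ℕ
    p q S T X Y Z : Subset n
    x y z u e : Fin n
    r r′ : ℕ
    F : Family n

△-comm : ∀ (p q : Subset n) → p △ q ≡ q △ p
△-comm = zipWith-comm xor-comm

△-assoc : ∀ (p q s : Subset n) → (p △ q) △ s ≡ p △ (q △ s)
△-assoc = zipWith-assoc xor-assoc

△-identityˡ : ∀ (p : Subset n) → ⊥ △ p ≡ p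
△-identityˡ = zipWith-identityˡ xor-identityˡ

△-identityʳ : ∀ (p : Subset n) → p △ ⊥ ≡ p
△-identityʳ = zipWith-identityʳ xor-identityʳ

△-self : ∀ (p : Subset n) → p △ p ≡ ⊥
△-self []      = refl
△-self (b ∷ p) = cong₂ _∷_ (xor-same b) (△-self p)

△-cancelʳ : ∀ (p q : Subset n) → (p △ q) △ q ≡ p
△-cancelʳ p q = begin
  (p △ q) △ q  ≡⟨ △-assoc p q q ⟩
  p △ (q △ q)  ≡⟨ cong (p △_) (△-self q) ⟩
  p △ ⊥        ≡⟨ △-identityʳ p ⟩
  p            ∎
  where open ≡-Reasoning

△-rcomm : ∀ (p q s : Subset n) → (p △ q) △ s ≡ (p △ s) △ q
△-rcomm p q s = begin
  (p △ q) △ s  ≡⟨ △-assoc p q s ⟩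
  p △ (q △ s)  ≡⟨ cong (p △_) (△-comm q s) ⟩
  p △ (s △ q)  ≡⟨ △-assoc p s q ⟨
  (p △ s) △ q  ∎
  where open ≡-Reasoning

⁅x⁆∪⁅y⁆≡⁅x⁆△⁅y⁆ : x ≢ y → ⁅ x ⁆ ∪ ⁅ y ⁆ ≡ ⁅ x ⁆ △ ⁅ y ⁆
⁅x⁆∪⁅y⁆≡⁅x⁆△⁅y⁆ {x = zero}  {y = zero}  x≢y = ⊥-elim (x≢y refl)
⁅x⁆∪⁅y⁆≡⁅x⁆△⁅y⁆ {x = zero}  {y = suc y} _   =
  cong (inside ∷_) (trans (∪-identityˡ ⁅ y ⁆) (sym (△-identityˡ ⁅ y ⁆)))
⁅x⁆∪⁅y⁆≡⁅x⁆△⁅y⁆ {x = suc x} {y = zero}  _   =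
  cong (inside ∷_) (trans (∪-identityʳ ⁅ x ⁆) (sym (△-identityʳ ⁅ x ⁆)))
⁅x⁆∪⁅y⁆≡⁅x⁆△⁅y⁆ {x = suc x} {y = suc y} x≢y =
  cong (outside ∷_) (⁅x⁆∪⁅y⁆≡⁅x⁆△⁅y⁆ (x≢y ∘ cong suc))

p△⁅x⁆∪⁅y⁆≡p△⁅x⁆△⁅y⁆ : ∀ (p : Subset n) → x ≢ y → p △ (⁅ x ⁆ ∪ ⁅ y ⁆) ≡ (p △ ⁅ x ⁆) △ ⁅ y ⁆
p△⁅x⁆∪⁅y⁆≡p△⁅x⁆△⁅y⁆ p x≢y =
  trans (cong (p △_) (⁅x⁆∪⁅y⁆≡⁅x⁆△⁅y⁆ x≢y)) (sym (△-assoc p _ _))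

lookup-△ : ∀ (p q : Subset n) x → lookup (p △ q) x ≡ lookup p x xor lookup q x
lookup-△ p q x = lookup-zipWith _xor_ x p q

∉⇒lookup≡false : x ∉ p → lookup p x ≡ false
∉⇒lookup≡false {x = x} {p = p} x∉p = ¬-not (x∉p ∘ lookup⇒[]= x p)

∈△⇒xor : x ∈ p △ q → lookup p x xor lookup q x ≡ true
∈△⇒xor {x = x} {p = p} {q = q} x∈p△q = trans (sym (lookup-△ p q x)) ([]=⇒lookup x∈p△q)

xor⇒∈△ : lookup p x xor lookup q x ≡ true → x ∈ p △ q
xor⇒∈△ {p = p} {x = x} {q = q} h = lookup⇒[]= x (p △ q) (trans (lookup-△ p q x) h)

x∈p∧x∉q⇒x∈p△q : x ∈ p → x ∉ q → x ∈ p △ q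
x∈p∧x∉q⇒x∈p△q x∈p x∉q = xor⇒∈△ (cong₂ _xor_ ([]=⇒lookup x∈p) (∉⇒lookup≡false x∉q))

x∉p∧x∈q⇒x∈p△q : x ∉ p → x ∈ q → x ∈ p △ q
x∉p∧x∈q⇒x∈p△q x∉p x∈q = xor⇒∈△ (cong₂ _xor_ (∉⇒lookup≡false x∉p) ([]=⇒lookup x∈q))

x∈p∧x∈q⇒x∉p△q : x ∈ p → x ∈ q → x ∉ p △ q
x∈p∧x∈q⇒x∉p△q x∈p x∈q x∈p△q
  with () ← trans (sym (cong₂ _xor_ ([]=⇒lookup x∈p) ([]=⇒lookup x∈q))) (∈△⇒xor x∈p△q)

x∉p∧x∉q⇒x∉p△q : x ∉ p → x ∉ q → x ∉ p △ q
x∉p∧x∉q⇒x∉p△q x∉p x∉q x∈p△q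
  with () ← trans (sym (cong₂ _xor_ (∉⇒lookup≡false x∉p) (∉⇒lookup≡false x∉q))) (∈△⇒xor x∈p△q)

x∈p⇒x∉p△⁅x⁆ : x ∈ p → x ∉ p △ ⁅ x ⁆
x∈p⇒x∉p△⁅x⁆ x∈p = x∈p∧x∈q⇒x∉p△q x∈p (x∈⁅x⁆ _)

x∉p⇒x∈p△⁅x⁆ : x ∉ p → x ∈ p △ ⁅ x ⁆
x∉p⇒x∈p△⁅x⁆ x∉p = x∉p∧x∈q⇒x∈p△q x∉p (x∈⁅x⁆ _)

y∉p△⁅x⁆⇒y∉p : y ∉ p △ ⁅ x ⁆ → y ≢ x → y ∉ p
y∉p△⁅x⁆⇒y∉p y∉p△⁅x⁆ y≢x y∈p = y∉p△⁅x⁆ (x∈p∧x∉q⇒x∈p△q y∈p (x≢y⇒x∉⁅y⁆ y≢x))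

x∉p⇒∣p△⁅x⁆∣≡1+∣p∣ : x ∉ p → ∣ p △ ⁅ x ⁆ ∣ ≡ suc ∣ p ∣
x∉p⇒∣p△⁅x⁆∣≡1+∣p∣ {x = zero}  {p = inside  ∷ p} x∉p = ⊥-elim (x∉p here)
x∉p⇒∣p△⁅x⁆∣≡1+∣p∣ {x = zero}  {p = outside ∷ p} _   = cong (suc ∘ ∣_∣) (△-identityʳ p)
x∉p⇒∣p△⁅x⁆∣≡1+∣p∣ {x = suc x} {p = inside  ∷ p} x∉p = cong suc (x∉p⇒∣p△⁅x⁆∣≡1+∣p∣ (x∉p ∘ there))
x∉p⇒∣p△⁅x⁆∣≡1+∣p∣ {x = suc x} {p = outside ∷ p} x∉p = x∉p⇒∣p△⁅x⁆∣≡1+∣p∣ (x∉p ∘ there)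

x∈p⇒1+∣p△⁅x⁆∣≡∣p∣ : x ∈ p → suc ∣ p △ ⁅ x ⁆ ∣ ≡ ∣ p ∣
x∈p⇒1+∣p△⁅x⁆∣≡∣p∣ {p = inside  ∷ p} here        = cong (suc ∘ ∣_∣) (△-identityʳ p)
x∈p⇒1+∣p△⁅x⁆∣≡∣p∣ {p = inside  ∷ p} (there x∈p) = cong suc (x∈p⇒1+∣p△⁅x⁆∣≡∣p∣ x∈p)
x∈p⇒1+∣p△⁅x⁆∣≡∣p∣ {p = outside ∷ p} (there x∈p) = x∈p⇒1+∣p△⁅x⁆∣≡∣p∣ x∈p

x∈p⇒p─⁅x⁆≡p△⁅x⁆ : x ∈ p → p ─ ⁅ x ⁆ ≡ p △ ⁅ x ⁆
x∈p⇒p─⁅x⁆≡p△⁅x⁆ {p = inside  ∷ p} here        = cong (outside ∷_) (trans (p─⊥≡p p) (sym (△-identityʳ p)))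
x∈p⇒p─⁅x⁆≡p△⁅x⁆ {p = inside  ∷ p} (there x∈p) = cong (inside ∷_) (x∈p⇒p─⁅x⁆≡p△⁅x⁆ x∈p)
x∈p⇒p─⁅x⁆≡p△⁅x⁆ {p = outside ∷ p} (there x∈p) = cong (outside ∷_) (x∈p⇒p─⁅x⁆≡p△⁅x⁆ x∈p)

∃∈p∉q-there : ∀ {a b} → (∃ λ x → x ∈ p × x ∉ q) → ∃ λ x → x ∈ a ∷ p × x ∉ b ∷ q
∃∈p∉q-there (x , x∈p , x∉q) = suc x , there x∈p , x∉q ∘ drop-there

∣q∣≤∣p∣⇒p≡q⊎∃∈p∉q : ∀ (p q : Subset n) → ∣ q ∣ ≤ ∣ p ∣ → p ≡ q ⊎ ∃ λ x → x ∈ p × x ∉ q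
∣q∣≤∣p∣⇒p≡q⊎∃∈p∉q []            []            _ = inj₁ refl
∣q∣≤∣p∣⇒p≡q⊎∃∈p∉q (inside  ∷ p) (outside ∷ q) _ = inj₂ (zero , here , λ ())
∣q∣≤∣p∣⇒p≡q⊎∃∈p∉q (inside  ∷ p) (inside  ∷ q) ∣q∣≤∣p∣ =
  Sum.map (cong (inside ∷_)) ∃∈p∉q-there (∣q∣≤∣p∣⇒p≡q⊎∃∈p∉q p q (s≤s⁻¹ ∣q∣≤∣p∣))
∣q∣≤∣p∣⇒p≡q⊎∃∈p∉q (outside ∷ p) (outside ∷ q) ∣q∣≤∣p∣ =
  Sum.map (cong (outside ∷_)) ∃∈p∉q-there (∣q∣≤∣p∣⇒p≡q⊎∃∈p∉q p q ∣q∣≤∣p∣)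
∣q∣≤∣p∣⇒p≡q⊎∃∈p∉q (outside ∷ p) (inside  ∷ q) ∣q∣<∣p∣
  with ∣q∣≤∣p∣⇒p≡q⊎∃∈p∉q p q (≤-trans (n≤1+n _) ∣q∣<∣p∣)
... | inj₁ refl = ⊥-elim (1+n≰n ∣q∣<∣p∣)
... | inj₂ ∃∈p∉q = inj₂ (∃∈p∉q-there ∃∈p∉q)

swap-size : x ∉ p → y ∈ p → ∣ (p △ ⁅ x ⁆) △ ⁅ y ⁆ ∣ ≡ ∣ p ∣
swap-size {x = x} {p = p} {y = y} x∉p y∈p = suc-injective (begin
  suc ∣ (p △ ⁅ x ⁆) △ ⁅ y ⁆ ∣  ≡⟨ x∈p⇒1+∣p△⁅x⁆∣≡∣p∣ y∈p△⁅x⁆ ⟩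
  ∣ p △ ⁅ x ⁆ ∣                ≡⟨ x∉p⇒∣p△⁅x⁆∣≡1+∣p∣ x∉p ⟩
  suc ∣ p ∣                    ∎)
  where
  open ≡-Reasoning
  y∈p△⁅x⁆ : y ∈ p △ ⁅ x ⁆
  y∈p△⁅x⁆ = x∈p∧x∉q⇒x∈p△q y∈p (x≢y⇒x∉⁅y⁆ λ { refl → x∉p y∈p })

swap-avoids : z ∉ p → z ≢ x → y ∈ p → z ∉ (p △ ⁅ x ⁆) △ ⁅ y ⁆
swap-avoids z∉p z≢x y∈p =
  x∉p∧x∉q⇒x∉p△q (x∉p∧x∉q⇒x∉p△q z∉p (x≢y⇒x∉⁅y⁆ z≢x)) (x≢y⇒x∉⁅y⁆ λ { refl → z∉p y∈p })

swap-approaches : x ∉ p → x ∈ q → y ∈ p → y ∉ q → ∣ ((p △ ⁅ x ⁆) △ ⁅ y ⁆) △ q ∣ < ∣ p △ q ∣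
swap-approaches {x = x} {p = p} {q = q} {y = y} x∉p x∈q y∈p y∉q = begin-strict
  ∣ ((p △ ⁅ x ⁆) △ ⁅ y ⁆) △ q ∣  ≡⟨ cong ∣_∣ (△-rcomm (p △ ⁅ x ⁆) ⁅ y ⁆ q) ⟩
  ∣ ((p △ ⁅ x ⁆) △ q) △ ⁅ y ⁆ ∣  ≡⟨ cong (λ t → ∣ t △ ⁅ y ⁆ ∣) (△-rcomm p ⁅ x ⁆ q) ⟩
  ∣ (D △ ⁅ x ⁆) △ ⁅ y ⁆ ∣        ≤⟨ n≤1+n _ ⟩
  suc ∣ (D △ ⁅ x ⁆) △ ⁅ y ⁆ ∣    ≡⟨ x∈p⇒1+∣p△⁅x⁆∣≡∣p∣ y∈D△⁅x⁆ ⟩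
  ∣ D △ ⁅ x ⁆ ∣                  <⟨ ≤-reflexive (x∈p⇒1+∣p△⁅x⁆∣≡∣p∣ x∈D) ⟩
  ∣ D ∣                          ∎
  where
  open ≤-Reasoning
  D = p △ q
  x∈D : x ∈ D
  x∈D = x∉p∧x∈q⇒x∈p△q x∉p x∈q
  y∈D△⁅x⁆ : y ∈ D △ ⁅ x ⁆
  y∈D△⁅x⁆ = x∈p∧x∉q⇒x∈p△q (x∈p∧x∉q⇒x∈p△q y∈p y∉q) (x≢y⇒x∉⁅y⁆ λ { refl → x∉p y∈p })

xor≡true⇒ : ∀ a b → a xor b ≡ true → a ≡ true ⊎ b ≡ true
xor≡true⇒ true  _ _ = inj₁ refl
xor≡true⇒ false _ h = inj₂ h

twist-feasible⁺ : ∀ (F : Family n) A X → Feasible F (X △ A) → Feasible (twist A F) X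
twist-feasible⁺ F A X = subst (Feasible F) (△-comm X A)

twist-feasible⁻ : ∀ (F : Family n) A X → Feasible (twist A F) X → Feasible F (X △ A)
twist-feasible⁻ F A X = subst (Feasible F) (△-comm A X)

module _ (F : Family n) (e : Fin n) where

  loopc-∉ : e ∉ Y → loopc e F Y ≡ F Y
  loopc-∉ {Y = Y} e∉Y rewrite ∉⇒lookup≡false e∉Y = xor-identityʳ (F Y)

  loopc-∈ : e ∈ Y → loopc e F Y ≡ F Y xor F (Y △ ⁅ e ⁆)
  loopc-∈ e∈Y rewrite []=⇒lookup e∈Y | x∈p⇒p─⁅x⁆≡p△⁅x⁆ e∈Y = refl

  loopc-feasible⁻ : Feasible (loopc e F) Y → Feasible F Y ⊎ (e ∈ Y × Feasible F (Y △ ⁅ e ⁆))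
  loopc-feasible⁻ {Y = Y} FY with e ∈? Y
  ... | no  e∉Y = inj₁ (trans (sym (loopc-∉ e∉Y)) FY)
  ... | yes e∈Y = Sum.map₂ (e∈Y ,_) (xor≡true⇒ (F Y) _ (trans (sym (loopc-∈ e∈Y)) FY))

rmax-attained : ∀ (P : ℕ → Set) → IsRmax F r → (∀ Y → Feasible F Y → P ∣ Y ∣) → P r
rmax-attained P ((X , FX , refl) , _) all = all X FX

rank⇒IsMaxFeasible : IsRmax F r → Feasible F X → ∣ X ∣ ≡ r → IsMaxFeasible F X
rank⇒IsMaxFeasible (_ , bounded) FX refl = FX , bounded

IsMaxFeasible⇒rank : IsRmax F r → IsMaxFeasible F X → ∣ X ∣ ≡ r
IsMaxFeasible⇒rank ((X₀ , FX₀ , refl) , bounded) (FX , maximal) = ≤-antisym (bounded _ FX) (maximal X₀ FX₀)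

module _ {F : Family n} {e : Fin n} (rank : IsRmax F r) where

  above-rank⇒infeasible : r < ∣ Y ∣ → F Y ≡ false
  above-rank⇒infeasible r<∣Y∣ = ¬-not λ FY → <⇒≱ r<∣Y∣ (proj₂ rank _ FY)

  loopc-bounded : Feasible (loopc e F) Y → ∣ Y ∣ ≤ suc r
  loopc-bounded {Y = Y} FY with loopc-feasible⁻ F e FY
  ... | inj₁ FY′             = m≤n⇒m≤1+n (proj₂ rank Y FY′)
  ... | inj₂ (e∈Y , FY△e) = begin
    ∣ Y ∣                ≡⟨ x∈p⇒1+∣p△⁅x⁆∣≡∣p∣ e∈Y ⟨
    suc ∣ Y △ ⁅ e ⁆ ∣    ≤⟨ s≤s (proj₂ rank _ FY△e) ⟩
    suc r                ∎
    where open ≤-Reasoning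

  avoider-at-rank⇒loopc-feasible : Feasible F X → ∣ X ∣ ≡ r → e ∉ X → Feasible (loopc e F) (X △ ⁅ e ⁆)
  avoider-at-rank⇒loopc-feasible {X = X} FX ∣X∣≡r e∉X = begin
    loopc e F (X △ ⁅ e ⁆)                          ≡⟨ loopc-∈ F e (x∉p⇒x∈p△⁅x⁆ e∉X) ⟩
    F (X △ ⁅ e ⁆) xor F ((X △ ⁅ e ⁆) △ ⁅ e ⁆)     ≡⟨ cong (F (X △ ⁅ e ⁆) xor_) (cong F (△-cancelʳ X ⁅ e ⁆)) ⟩
    F (X △ ⁅ e ⁆) xor F X                          ≡⟨ cong₂ _xor_ X△e-infeasible FX ⟩
    true                                           ∎
    where
    open ≡-Reasoning
    X△e-infeasible = above-rank⇒infeasible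
      (≤-reflexive (sym (trans (x∉p⇒∣p△⁅x⁆∣≡1+∣p∣ e∉X) (cong suc ∣X∣≡r))))

  non-coloop⇒avoider-at-rank : ¬ RibbonDualLoop F e → ∃ λ X → Feasible F X × ∣ X ∣ ≡ r × e ∉ X
  non-coloop⇒avoider-at-rank ¬coloop with anySubset? (λ X → (F X Bool.≟ true) ×-dec (∣ X ∣ ℕ.≟ r) ×-dec ¬? (e ∈? X))
  ... | yes avoider = avoider
  ... | no  none    = ⊥-elim (¬coloop λ X max →
          decidable-stable (e ∈? X) λ e∉X → none (X , proj₁ max , IsMaxFeasible⇒rank rank max , e∉X))

  non-coloop⇒rank-up : ¬ RibbonDualLoop F e → IsRmax (loopc e F) r′ → suc r ≡ r′
  non-coloop⇒rank-up ¬coloop rank′ with non-coloop⇒avoider-at-rank ¬coloop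
  ... | X , FX , ∣X∣≡r , e∉X = ≤-antisym r+1≤r′ (rmax-attained (_≤ suc _) rank′ λ _ → loopc-bounded)
    where
    r+1≤r′ = subst (_≤ _) (trans (x∉p⇒∣p△⁅x⁆∣≡1+∣p∣ e∉X) (cong suc ∣X∣≡r))
               (proj₂ rank′ _ (avoider-at-rank⇒loopc-feasible FX ∣X∣≡r e∉X))

module _ {F : Family n} (dm : IsDeltaMatroid F) (bounded : ∀ Y → Feasible F Y → ∣ Y ∣ ≤ r) where

  exchange-toward : Feasible F T → Feasible F S → r ≤ suc ∣ T ∣ → u ∈ S → u ∉ T →
    Feasible F (T △ ⁅ u ⁆) ⊎
    ∃ λ T′ → Feasible F T′ × ∣ T′ ∣ ≡ ∣ T ∣ × ∣ T′ △ S ∣ < ∣ T △ S ∣ ×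
             (∀ {x} → x ∉ T → x ≢ u → x ∉ T′)
  exchange-toward {T = T} {S = S} {u = u} FT FS r≤1+∣T∣ u∈S u∉T
    with proj₂ dm T S FT FS u (x∉p∧x∈q⇒x∈p△q u∉T u∈S)
  ... | w , w∈T△S , FT△uw with w Fin.≟ u
  ...   | yes refl = inj₁ (subst (Feasible F) (cong (T △_) (∪-idem ⁅ w ⁆)) FT△uw)
  ...   | no  w≢u with w ∈? T | subst (Feasible F) (p△⁅x⁆∪⁅y⁆≡p△⁅x⁆△⁅y⁆ T (w≢u ∘ sym)) FT△uw
  ...     | yes w∈T | FT′ =
    inj₂ (_ , FT′ , swap-size u∉T w∈T , swap-approaches u∉T u∈S w∈T w∉S ,
          λ x∉T x≢u → swap-avoids x∉T x≢u w∈T)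
    where
    w∉S : w ∉ S
    w∉S w∈S = x∈p∧x∈q⇒x∉p△q w∈T w∈S w∈T△S
  ...     | no  w∉T | FT′ = ⊥-elim (1+n≰n (begin
    suc (suc ∣ T ∣)           ≡⟨ cong suc (x∉p⇒∣p△⁅x⁆∣≡1+∣p∣ u∉T) ⟨
    suc ∣ T △ ⁅ u ⁆ ∣         ≡⟨ x∉p⇒∣p△⁅x⁆∣≡1+∣p∣ (x∉p∧x∉q⇒x∉p△q w∉T (x≢y⇒x∉⁅y⁆ w≢u)) ⟨
    ∣ (T △ ⁅ u ⁆) △ ⁅ w ⁆ ∣   ≤⟨ bounded _ FT′ ⟩
    r                         ≤⟨ r≤1+∣T∣ ⟩
    suc ∣ T ∣                 ∎))
    where open ≤-Reasoning

module Coloop {F : Family n} {e : Fin n} (dm : IsDeltaMatroid F) (rank : IsRmax F r)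
  (coloop : ∀ X → Feasible F X → ∣ X ∣ ≡ r → e ∈ X) where

  bounded : ∀ Y → Feasible F Y → ∣ Y ∣ ≤ r
  bounded = proj₂ rank

  avoider⇒below-rank : Feasible F Z → e ∉ Z → suc ∣ Z ∣ ≤ r
  avoider⇒below-rank {Z = Z} FZ e∉Z = ≤∧≢⇒< (bounded Z FZ) (e∉Z ∘ coloop Z FZ)

  AvoiderBelowRank : Set
  AvoiderBelowRank = ∃ λ W → Feasible F W × e ∉ W × suc ∣ W ∣ ≡ r

  twin-of-feasible : S ≡ T △ ⁅ e ⁆ → Feasible F T → Feasible F (S △ ⁅ e ⁆)
  twin-of-feasible {T = T} refl = subst (Feasible F) (sym (△-cancelʳ T ⁅ e ⁆))

  at-rank⇒minus-e-feasible : AvoiderBelowRank → Feasible F Y → ∣ Y ∣ ≡ r → Feasible F (Y △ ⁅ e ⁆)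
  at-rank⇒minus-e-feasible {Y = Y} (W , FW , e∉W , ∣W∣+1≡r) FY ∣Y∣≡r = go W (<-wellFounded _) FW e∉W ∣W∣+1≡r
    where
    go : ∀ T → Acc _<_ ∣ T △ Y ∣ → Feasible F T → e ∉ T → suc ∣ T ∣ ≡ r → Feasible F (Y △ ⁅ e ⁆)
    go T (acc closer) FT e∉T ∣T∣+1≡r =
      [ (λ Y≡T△e → twin-of-feasible Y≡T△e FT) , step ]′
        (∣q∣≤∣p∣⇒p≡q⊎∃∈p∉q Y (T △ ⁅ e ⁆) (≤-reflexive ∣T△e∣≡∣Y∣))
      where
      ∣T△e∣≡∣Y∣ : ∣ T △ ⁅ e ⁆ ∣ ≡ ∣ Y ∣
      ∣T△e∣≡∣Y∣ = trans (x∉p⇒∣p△⁅x⁆∣≡1+∣p∣ e∉T) (trans ∣T∣+1≡r (sym ∣Y∣≡r))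
      step : (∃ λ u → u ∈ Y × u ∉ T △ ⁅ e ⁆) → Feasible F (Y △ ⁅ e ⁆)
      step (u , u∈Y , u∉T△e) =
        [ (λ FT△u → ⊥-elim (e∉T△u (coloop _ FT△u ∣T△u∣≡r))) , recurse ]′
          (exchange-toward dm bounded FT FY (≤-reflexive (sym ∣T∣+1≡r)) u∈Y u∉T)
        where
        u≢e : u ≢ e
        u≢e refl = u∉T△e (x∉p⇒x∈p△⁅x⁆ e∉T)
        u∉T = y∉p△⁅x⁆⇒y∉p u∉T△e u≢e
        e∉T△u = x∉p∧x∉q⇒x∉p△q e∉T (x≢y⇒x∉⁅y⁆ (u≢e ∘ sym))
        ∣T△u∣≡r = trans (x∉p⇒∣p△⁅x⁆∣≡1+∣p∣ u∉T) ∣T∣+1≡r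
        recurse = λ { (T′ , FT′ , ∣T′∣≡∣T∣ , approaches , keeps∉) →
          go T′ (closer approaches) FT′ (keeps∉ e∉T (u≢e ∘ sym)) (trans (cong suc ∣T′∣≡∣T∣) ∣T∣+1≡r) }

  below-rank⇒plus-e-feasible : Feasible F Z → e ∉ Z → suc ∣ Z ∣ ≡ r → Feasible F (Z △ ⁅ e ⁆)
  below-rank⇒plus-e-feasible {Z = Z} FZ e∉Z ∣Z∣+1≡r with proj₁ rank
  ... | X₀ , FX₀ , ∣X₀∣≡r = go X₀ (<-wellFounded _) FX₀ ∣X₀∣≡r
    where
    go : ∀ T → Acc _<_ ∣ T △ Z ∣ → Feasible F T → ∣ T ∣ ≡ r → Feasible F (Z △ ⁅ e ⁆)
    go T (acc closer) FT ∣T∣≡r =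
      [ (λ Z≡T△e → twin-of-feasible Z≡T△e FT) , step ]′
        (∣q∣≤∣p∣⇒p≡q⊎∃∈p∉q Z (T △ ⁅ e ⁆) (≤-reflexive ∣T△e∣≡∣Z∣))
      where
      ∣T△e∣≡∣Z∣ : ∣ T △ ⁅ e ⁆ ∣ ≡ ∣ Z ∣
      ∣T△e∣≡∣Z∣ = suc-injective
        (trans (x∈p⇒1+∣p△⁅x⁆∣≡∣p∣ (coloop T FT ∣T∣≡r)) (trans ∣T∣≡r (sym ∣Z∣+1≡r)))
      step : (∃ λ u → u ∈ Z × u ∉ T △ ⁅ e ⁆) → Feasible F (Z △ ⁅ e ⁆)
      step (u , u∈Z , u∉T△e) =
        [ (λ FT△u → ⊥-elim (<⇒≱ r<∣T△u∣ (bounded _ FT△u))) , recurse ]′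
          (exchange-toward dm bounded FT FZ (m≤n⇒m≤1+n (≤-reflexive (sym ∣T∣≡r))) u∈Z u∉T)
        where
        u∉T = y∉p△⁅x⁆⇒y∉p u∉T△e λ { refl → e∉Z u∈Z }
        r<∣T△u∣ = ≤-reflexive (sym (trans (x∉p⇒∣p△⁅x⁆∣≡1+∣p∣ u∉T) (cong suc ∣T∣≡r)))
        recurse = λ { (T′ , FT′ , ∣T′∣≡∣T∣ , approaches , _) →
          go T′ (closer approaches) FT′ (trans ∣T′∣≡∣T∣ ∣T∣≡r) }

  flip-e-at-rank : AvoiderBelowRank → e ∈ Y → ∣ Y ∣ ≡ r → F Y ≡ F (Y △ ⁅ e ⁆)
  flip-e-at-rank {Y = Y} avoider e∈Y ∣Y∣≡r with F Y in FY
  ... | true  = sym (at-rank⇒minus-e-feasible avoider FY ∣Y∣≡r)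
  ... | false with F (Y △ ⁅ e ⁆) in FY△e
  ...   | false = refl
  ...   | true with () ← trans (sym FY) (subst (Feasible F) (△-cancelʳ Y ⁅ e ⁆)
                    (below-rank⇒plus-e-feasible FY△e (x∈p⇒x∉p△⁅x⁆ e∈Y)
                      (trans (x∈p⇒1+∣p△⁅x⁆∣≡∣p∣ e∈Y) ∣Y∣≡r)))

  loopc-bounded-by-rank : Feasible (loopc e F) Y → ∣ Y ∣ ≤ r
  loopc-bounded-by-rank {Y = Y} FY with loopc-feasible⁻ F e FY
  ... | inj₁ FY′          = bounded Y FY′
  ... | inj₂ (e∈Y , FY△e) = subst (_≤ r) (x∈p⇒1+∣p△⁅x⁆∣≡∣p∣ e∈Y)
                              (avoider⇒below-rank FY△e (x∈p⇒x∉p△⁅x⁆ e∈Y))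

  avoider⇒loopc-infeasible-at-rank : AvoiderBelowRank → e ∈ Y → ∣ Y ∣ ≡ r → loopc e F Y ≡ false
  avoider⇒loopc-infeasible-at-rank {Y = Y} avoider e∈Y ∣Y∣≡r = begin
    loopc e F Y             ≡⟨ loopc-∈ F e e∈Y ⟩
    F Y xor F (Y △ ⁅ e ⁆)   ≡⟨ cong (F Y xor_) (flip-e-at-rank avoider e∈Y ∣Y∣≡r) ⟨
    F Y xor F Y             ≡⟨ xor-same (F Y) ⟩
    false                   ∎
    where open ≡-Reasoning

  avoider⇒loopc-below-rank : AvoiderBelowRank → Feasible (loopc e F) Y → suc ∣ Y ∣ ≤ r
  avoider⇒loopc-below-rank {Y = Y} avoider FY = ≤∧≢⇒< (loopc-bounded-by-rank FY) not-at-rank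
    where
    not-at-rank : ∣ Y ∣ ≢ r
    not-at-rank ∣Y∣≡r with e ∈? Y
    ... | no  e∉Y = e∉Y (coloop Y (trans (sym (loopc-∉ F e e∉Y)) FY) ∣Y∣≡r)
    ... | yes e∈Y with () ← trans (sym (avoider⇒loopc-infeasible-at-rank avoider e∈Y ∣Y∣≡r)) FY

  avoider⇒rank-drop : AvoiderBelowRank → IsRmax (loopc e F) r′ → r ≡ suc r′
  avoider⇒rank-drop avoider@(W , FW , e∉W , ∣W∣+1≡r) rank′ = ≤-antisym
    (subst (_≤ _) ∣W∣+1≡r (s≤s (proj₂ rank′ W (trans (loopc-∉ F e e∉W) FW))))
    (rmax-attained (λ k → suc k ≤ r) rank′ λ _ → avoider⇒loopc-below-rank avoider)

  no-avoider⇒rank-kept : ¬ AvoiderBelowRank → IsRmax (loopc e F) r′ → r ≡ r′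
  no-avoider⇒rank-kept none rank′ with proj₁ rank
  ... | X₀ , FX₀ , ∣X₀∣≡r = ≤-antisym
    (subst (_≤ _) ∣X₀∣≡r (proj₂ rank′ X₀ X₀∈loopc))
    (rmax-attained (_≤ r) rank′ λ _ → loopc-bounded-by-rank)
    where
    e∈X₀ = coloop X₀ FX₀ ∣X₀∣≡r
    X₀△e-infeasible : F (X₀ △ ⁅ e ⁆) ≡ false
    X₀△e-infeasible = ¬-not λ FX₀△e →
      none (_ , FX₀△e , x∈p⇒x∉p△⁅x⁆ e∈X₀ ,
            trans (x∈p⇒1+∣p△⁅x⁆∣≡∣p∣ e∈X₀) ∣X₀∣≡r)
    X₀∈loopc : Feasible (loopc e F) X₀
    X₀∈loopc = trans (loopc-∈ F e e∈X₀) (cong₂ _xor_ FX₀ X₀△e-infeasible)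

  avoider⇒twist-coloop : AvoiderBelowRank → InAllMaxOfTwist F e
  avoider⇒twist-coloop (W , FW , e∉W , ∣W∣+1≡r) X (FX , maximal) =
    decidable-stable (e ∈? X) λ e∉X → 1+n≰n (begin
      suc ∣ X ∣            ≡⟨ x∉p⇒∣p△⁅x⁆∣≡1+∣p∣ e∉X ⟨
      ∣ X △ ⁅ e ⁆ ∣        ≤⟨ bounded _ (twist-feasible⁻ F ⁅ e ⁆ X FX) ⟩
      r                    ≡⟨ trans (sym ∣W∣+1≡r) (sym (x∉p⇒∣p△⁅x⁆∣≡1+∣p∣ e∉W)) ⟩
      ∣ W △ ⁅ e ⁆ ∣        ≤⟨ maximal _ (twist-feasible⁺ F ⁅ e ⁆ _ (subst (Feasible F) (sym (△-cancelʳ W ⁅ e ⁆)) FW)) ⟩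
      ∣ X ∣                ∎)
    where open ≤-Reasoning

  no-avoider⇒twist-below-rank : ¬ AvoiderBelowRank → Feasible (twist ⁅ e ⁆ F) Y → suc ∣ Y ∣ ≤ r
  no-avoider⇒twist-below-rank {Y = Y} none FY with e ∈? Y
  ... | no  e∉Y = subst (_≤ r) (x∉p⇒∣p△⁅x⁆∣≡1+∣p∣ e∉Y) (bounded _ (twist-feasible⁻ F ⁅ e ⁆ Y FY))
  ... | yes e∈Y = subst (λ k → suc k ≤ r) (x∈p⇒1+∣p△⁅x⁆∣≡∣p∣ e∈Y)
                    (≤∧≢⇒< (avoider⇒below-rank FW e∉W) λ ∣W∣+1≡r → none (_ , FW , e∉W , ∣W∣+1≡r))
    where
    FW = twist-feasible⁻ F ⁅ e ⁆ Y FY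
    e∉W = x∈p⇒x∉p△⁅x⁆ e∈Y

  no-avoider⇒twist-not-coloop : ¬ AvoiderBelowRank → ¬ InAllMaxOfTwist F e
  no-avoider⇒twist-not-coloop none inAll with proj₁ rank
  ... | X₀ , FX₀ , ∣X₀∣≡r = x∈p⇒x∉p△⁅x⁆ e∈X₀ (inAll _ (FZ₀ , Z₀-maximal))
    where
    e∈X₀ = coloop X₀ FX₀ ∣X₀∣≡r
    FZ₀ : Feasible (twist ⁅ e ⁆ F) (X₀ △ ⁅ e ⁆)
    FZ₀ = twist-feasible⁺ F ⁅ e ⁆ _ (subst (Feasible F) (sym (△-cancelʳ X₀ ⁅ e ⁆)) FX₀)
    Z₀-maximal : ∀ Y → Feasible (twist ⁅ e ⁆ F) Y → ∣ Y ∣ ≤ ∣ X₀ △ ⁅ e ⁆ ∣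
    Z₀-maximal Y FY = s≤s⁻¹ (subst (suc ∣ Y ∣ ≤_)
      (sym (trans (x∈p⇒1+∣p△⁅x⁆∣≡∣p∣ e∈X₀) ∣X₀∣≡r)) (no-avoider⇒twist-below-rank none FY))

  orientation-dichotomy : IsRmax (loopc e F) r′ →
    (InAllMaxOfTwist F e × r ≡ suc r′) ⊎ (¬ InAllMaxOfTwist F e × r ≡ r′)
  orientation-dichotomy rank′
    with anySubset? (λ W → (F W Bool.≟ true) ×-dec ¬? (e ∈? W) ×-dec (suc ∣ W ∣ ℕ.≟ r))
  ... | yes avoider = inj₁ (avoider⇒twist-coloop avoider , avoider⇒rank-drop avoider rank′)
  ... | no  none    = inj₂ (no-avoider⇒twist-not-coloop none , no-avoider⇒rank-kept none rank′)

lemma3p54 : ∀ {n} (F : Family n) (e : Fin n) → VfSafe F →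
    ∀ (r r' : ℕ) → IsRmax F r → IsRmax (loopc e F) r' →
      (OrientableRDL F e → r ≡ r') ×
      (¬ RibbonDualLoop F e → suc r ≡ r') ×
      (NonOrientableRDL F e → r ≡ suc r')
lemma3p54 F e vf r r′ rank rank′ =
  orientable , (λ ¬coloop → non-coloop⇒rank-up rank ¬coloop rank′) , non-orientable
  where
  dichotomy : RibbonDualLoop F e →
    (InAllMaxOfTwist F e × r ≡ suc r′) ⊎ (¬ InAllMaxOfTwist F e × r ≡ r′)
  dichotomy coloop = Coloop.orientation-dichotomy (vf List.[]) rank
    (λ X FX ∣X∣≡r → coloop X (rank⇒IsMaxFeasible rank FX ∣X∣≡r)) rank′

  orientable : OrientableRDL F e → r ≡ r′
  orientable (coloop , ¬inAll) = [ (λ (inAll , _) → ⊥-elim (¬inAll inAll)) , proj₂ ]′ (dichotomy coloop)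

  non-orientable : NonOrientableRDL F e → r ≡ suc r′
  non-orientable (coloop , inAll) = [ proj₂ , (λ (¬inAll , _) → ⊥-elim (¬inAll inAll)) ]′ (dichotomy coloop)
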